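{- If $G$ is a connected graph, then (i) $\mathrm{gp}(G)\le 2\,\mathrm{ip}(G)$, and (ii) $\mathrm{gp}(G)\le 3\,\mathrm{ic}(G)$.
   Context: For a connected graph $G$, a set $S\subseteq V(G)$ is a general position set if no three distinct vertices of $S$ lie on a common geodesic (shortest path) of $G$; $\mathrm{gp}(G)$ is the maximum cardinality of such a set. The isometric-path number $\mathrm{ip}(G)$ is the minimum number of geodesics (isometric paths) of $G$ whose vertex sets cover $V(G)$. The isometric-cycle number $\mathrm{ic}(G)$ is the minimum number of isometric cycles of $G$ (cycles that are isometric subgraphs, i.e. distances within the cycle equal distances in $G$) whose vertex sets cover $V(G)$. -}

module Defs where

open import Data.Nat using (ℕ; zero; suc; _≤_; _∸_; _⊓_; ∣_-_∣; _+_)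
open import Data.Fin using (Fin; toℕ)
open import Data.Fin.Subset using (Subset; _∈_; ∣_∣)
open import Data.List using (List; []; _∷_; length)
import Data.List.Membership.Propositional as LM
open import Data.Product using (Σ; ∃; _×_; _,_)
open import Data.Empty using (⊥)
open import Relation.Nullary using (¬_)
open import Relation.Binary.PropositionalEquality using (_≡_; _≢_)
open import Function.Definitions using (Injective)
open import Level using (0ℓ)

record Graph : Set₁ where
  field
    n      : ℕ
    Adj    : Fin n → Fin n → Set
    sym    : ∀ {u v} → Adj u v → Adj v u
    irrefl : ∀ {u} → ¬ Adj u u

module _ (G : Graph) where
  open Graph G

  V : Set
  V = Fin n

  data WalkL : V → V → List V → Set where
    single : ∀ v → WalkL v v (v ∷ [])
    step   : ∀ {u w v vs} → Adj u w → WalkL w v vs → WalkL u v (u ∷ vs)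

  -- there is a u,v-walk with exactly k edges
  WalkLen : V → V → ℕ → Set
  WalkLen u v k = Σ (List V) λ vs → WalkL u v vs × length vs ≡ suc k

  Dist : V → V → ℕ → Set
  Dist u v k = WalkLen u v k × (∀ m → WalkLen u v m → k ≤ m)

  Connected : Set
  Connected = ∀ u v → ∃ λ k → WalkLen u v k

  Geodesic : List V → Set
  Geodesic vs = Σ V λ u → Σ V λ v → WalkL u v vs × Dist u v (length vs ∸ 1)

  GeneralPosition : Subset n → Set
  GeneralPosition S =
    ∀ x y z → x ∈ S → y ∈ S → z ∈ S → x ≢ y → y ≢ z → x ≢ z →
      ∀ P → Geodesic P → ¬ (LM._∈_ x P × LM._∈_ y P × LM._∈_ z P)

  IsGP : ℕ → Set
  IsGP k = (Σ (Subset n) λ S → GeneralPosition S × ∣ S ∣ ≡ k)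
         × (∀ S → GeneralPosition S → ∣ S ∣ ≤ k)

  data AllGeo : List (List V) → Set where
    []  : AllGeo []
    _∷_ : ∀ {P Ps} → Geodesic P → AllGeo Ps → AllGeo (P ∷ Ps)

  GeoCover : List (List V) → Set
  GeoCover Ps = AllGeo Ps × (∀ x → Σ (List V) λ P → LM._∈_ P Ps × LM._∈_ x P)

  IsIP : ℕ → Set
  IsIP k = (Σ (List (List V)) λ Ps → GeoCover Ps × length Ps ≡ k)
         × (∀ Ps → GeoCover Ps → k ≤ length Ps)

  record Cycle : Set where
    field
      m     : ℕ
      m≥3   : 3 ≤ m
      vert  : Fin m → V
      inj   : Injective _≡_ _≡_ vert

    cdist : Fin m → Fin m → ℕ
    cdist i j = ∣ toℕ i - toℕ j ∣ ⊓ (m ∸ ∣ toℕ i - toℕ j ∣)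

    field
      edges : ∀ i j → cdist i j ≡ 1 → Adj (vert i) (vert j)

  Isometric : Cycle → Set
  Isometric C = ∀ i j → Dist (vert i) (vert j) (cdist i j)
    where open Cycle C

  data AllIsoCyc : List Cycle → Set where
    []  : AllIsoCyc []
    _∷_ : ∀ {C Cs} → Isometric C → AllIsoCyc Cs → AllIsoCyc (C ∷ Cs)

  OnCycle : V → Cycle → Set
  OnCycle x C = ∃ λ i → Cycle.vert C i ≡ x

  IsoCycCover : List Cycle → Set
  IsoCycCover Cs = AllIsoCyc Cs × (∀ x → Σ Cycle λ C → LM._∈_ C Cs × OnCycle x C)

  IsIC : ℕ → Set
  IsIC k = (Σ (List Cycle) λ Cs → IsoCycCover Cs × length Cs ≡ k)
         × (∀ Cs → IsoCycCover Cs → k ≤ length Cs)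

-- A geodesic contains at most two points of a general position set S. An isometric
-- cycle contains at most three: of four points on a cycle, the four arcs between
-- cyclically consecutive ones sum to the cycle length, so two adjacent arcs together
-- span at most half of it; then the middle point of those two arcs lies on a geodesic
-- between the other two. Counting the points of S block by block in a cover of V(G) by
-- ip(G) geodesics, resp. ic(G) isometric cycles, gives the two bounds.
module Submission where

open import Defs
open import Data.Bool using (true; false)
open import Data.Empty using (⊥; ⊥-elim)
open import Data.Fin using (Fin; zero; suc; toℕ)
import Data.Fin.Properties as Fin
open import Data.Fin.Subset using (Subset; ∣_∣) renaming (_∈_ to _∈ₛ_)
open import Data.List using (List; []; _∷_; length; map; filter)
open import Data.List.Properties using (length-map)
open import Data.List.Membership.Propositional using (_∈_)
open import Data.List.Membership.Propositional.Properties using (∈-filter⁻)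
open import Data.List.Relation.Binary.Subset.Propositional using (_⊆_)
import Data.List.Relation.Binary.Sublist.Propositional.Properties as Sublist
open import Data.List.Relation.Binary.Permutation.Propositional using (_↭_; ↭-sym; ↭⇒↭ₛ)
open import Data.List.Relation.Binary.Permutation.Propositional.Properties using (↭-length; All-resp-↭)
import Data.List.Relation.Binary.Permutation.Setoid.Properties as Permutation
open import Data.List.Relation.Unary.All as All using (All; []; _∷_)
import Data.List.Relation.Unary.All.Properties as All
open import Data.List.Relation.Unary.AllPairs using ([]; _∷_)
open import Data.List.Relation.Unary.Any using (here; there)
open import Data.List.Relation.Unary.Linked using (Linked; _∷_)
open import Data.List.Relation.Unary.Unique.Propositional using (Unique)
import Data.List.Relation.Unary.Unique.Propositional.Properties as Unique
import Data.List.Sort as Sort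
open import Data.Nat using (ℕ; suc; _+_; _*_; _∸_; _⊓_; ∣_-_∣; _≤_; _<_; z≤n; s≤s)
open import Data.Nat.Properties
open import Data.Nat.Tactic.RingSolver using (solve)
open import Data.Product using (∃; _×_; _,_)
open import Data.Sum using (_⊎_; inj₁; inj₂)
import Data.Vec.Base as Vec
open Vec using ([]; _∷_)
open import Relation.Binary.PropositionalEquality
open import Relation.Nullary using (Dec; yes; no; contradiction; ¬_)
open import Relation.Unary.Properties using (∁?)

elements : ∀ {n} → Subset n → List (Fin n)
elements []          = []
elements (true ∷ p)  = zero ∷ map suc (elements p)
elements (false ∷ p) = map suc (elements p)

length-elements : ∀ {n} (p : Subset n) → length (elements p) ≡ ∣ p ∣
length-elements []          = refl
length-elements (true ∷ p)  = cong suc (trans (length-map suc (elements p)) (length-elements p))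
length-elements (false ∷ p) = trans (length-map suc (elements p)) (length-elements p)

elements-⊆ : ∀ {n} (p : Subset n) → All (_∈ₛ p) (elements p)
elements-⊆ []          = []
elements-⊆ (true ∷ p)  = Vec.here ∷ All.map⁺ (All.map Vec.there (elements-⊆ p))
elements-⊆ (false ∷ p) = All.map⁺ (All.map Vec.there (elements-⊆ p))

elements-Unique : ∀ {n} (p : Subset n) → Unique (elements p)
elements-Unique []          = []
elements-Unique (true ∷ p)  =
  All.map⁺ (All.universal (λ _ ()) (elements p)) ∷ Unique.map⁺ Fin.suc-injective (elements-Unique p)
elements-Unique (false ∷ p) = Unique.map⁺ Fin.suc-injective (elements-Unique p)

length-filter+length-filter-∁ : ∀ {A : Set} {P : A → Set} (P? : ∀ x → Dec (P x)) (xs : List A) →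
  length (filter P? xs) + length (filter (∁? P?) xs) ≡ length xs
length-filter+length-filter-∁ P? []       = refl
length-filter+length-filter-∁ P? (x ∷ xs) with P? x
... | yes _ = cong suc (length-filter+length-filter-∁ P? xs)
... | no _  = trans (+-suc _ _) (cong suc (length-filter+length-filter-∁ P? xs))

module _ {A B : Set} {_∈ᵇ_ : A → B → Set} (_∈ᵇ?_ : ∀ x b → Dec (x ∈ᵇ b)) where

  length-≤-*-blocks : ∀ k (bs : List B) (xs : List A) →
    (∀ {x} → x ∈ xs → ∃ λ b → b ∈ bs × x ∈ᵇ b) →
    (∀ {b} → b ∈ bs → length (filter (_∈ᵇ? b) xs) ≤ k) →
    length xs ≤ k * length bs
  length-≤-*-blocks k []       []      covered bounded = z≤n
  length-≤-*-blocks k []       (x ∷ _) covered bounded with covered (here refl)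
  ... | _ , () , _
  length-≤-*-blocks k (b ∷ bs) xs      covered bounded = begin
    length xs
      ≡⟨ length-filter+length-filter-∁ (_∈ᵇ? b) xs ⟨
    length (filter (_∈ᵇ? b) xs) + length outside
      ≤⟨ +-mono-≤ (bounded (here refl)) (length-≤-*-blocks k bs outside covered′ bounded′) ⟩
    k + k * length bs
      ≡⟨ *-suc k (length bs) ⟨
    k * length (b ∷ bs) ∎
    where
    open ≤-Reasoning
    outside : List A
    outside = filter (∁? (_∈ᵇ? b)) xs

    covered′ : ∀ {x} → x ∈ outside → ∃ λ b′ → b′ ∈ bs × x ∈ᵇ b′
    covered′ x∈ with ∈-filter⁻ (∁? (_∈ᵇ? b)) x∈
    ... | x∈xs , x∉b with covered x∈xs
    ...   | _ , here refl , x∈b = contradiction x∈b x∉b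
    ...   | b′ , there b′∈ , x∈b′ = b′ , b′∈ , x∈b′

    bounded′ : ∀ {b′} → b′ ∈ bs → length (filter (_∈ᵇ? b′) outside) ≤ k
    bounded′ {b′} b′∈ = ≤-trans
      (Sublist.length-mono-≤ (Sublist.filter⁺ (_∈ᵇ? b′) (_∈ᵇ? b′) (λ { refl p → p })
                                              (Sublist.filter-⊆ {P = λ x → ¬ (x ∈ᵇ b)} (∁? (_∈ᵇ? b)) xs)))
      (bounded (there b′∈))

∣p∣≤k*length : ∀ {n} {B : Set} {_∈ᵇ_ : Fin n → B → Set} (_∈ᵇ?_ : ∀ x b → Dec (x ∈ᵇ b))
  (p : Subset n) k (bs : List B) →
  (∀ x → ∃ λ b → b ∈ bs × x ∈ᵇ b) →
  (∀ {b} → b ∈ bs → ∀ {ys} → Unique ys → All (_∈ₛ p) ys → All (_∈ᵇ b) ys → length ys ≤ k) →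
  ∣ p ∣ ≤ k * length bs
∣p∣≤k*length _∈ᵇ?_ p k bs covers bounded =
  subst (_≤ k * length bs) (length-elements p)
    (length-≤-*-blocks _∈ᵇ?_ k bs (elements p) (λ {x} _ → covers x) λ b∈ →
      bounded b∈ (Unique.filter⁺ _ (elements-Unique p))
                 (All.filter⁺ _ (elements-⊆ p))
                 (All.all-filter _ (elements p)))

cyclicDist : ℕ → ℕ → ℕ → ℕ
cyclicDist m x y = ∣ x - y ∣ ⊓ (m ∸ ∣ x - y ∣)

cyclicDist-comm : ∀ m x y → cyclicDist m x y ≡ cyclicDist m y x
cyclicDist-comm m x y rewrite ∣-∣-comm x y = refl

cyclicDist-arc : ∀ {m x y} t u → x + t ≡ y → t + u ≡ m → cyclicDist m x y ≡ t ⊓ u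
cyclicDist-arc {x = x} t u refl refl rewrite ∣m-m+n∣≡n x t | m+n∸m≡n t u = refl

cyclicDist-shortArc : ∀ {m x y} t u → x + t ≡ y → t + u ≡ m → t ≤ u → cyclicDist m x y ≡ t
cyclicDist-shortArc t u x+t≡y t+u≡m t≤u = trans (cyclicDist-arc t u x+t≡y t+u≡m) (m≤n⇒m⊓n≡m t≤u)

cyclicDist-longArc : ∀ {m x y} t u → x + t ≡ y → t + u ≡ m → u ≤ t → cyclicDist m x y ≡ u
cyclicDist-longArc t u x+t≡y t+u≡m u≤t = trans (cyclicDist-arc t u x+t≡y t+u≡m) (m≥n⇒m⊓n≡n u≤t)

-- Positions a ≤ b ≤ c ≤ d < m on a cycle of length m, cut into the arcs p, q, r
-- and the arc w from d around to a.
module FourArcs (a p q r s : ℕ) where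

  b c d w m : ℕ
  b = a + p
  c = b + q
  d = c + r
  w = suc s + a
  m = suc d + s

  private
    variables : List ℕ
    variables = a ∷ p ∷ q ∷ r ∷ s ∷ []

  -- Each arc plus its complement is the whole cycle; w and m are unfolded since the
  -- solver treats defined names as atoms.
  arcs-ab : p + (q + (r + (suc s + a))) ≡ suc (a + p + q + r) + s
  arcs-ab = solve variables

  arcs-bc : q + (p + (r + (suc s + a))) ≡ suc (a + p + q + r) + s
  arcs-bc = solve variables

  arcs-ac : p + q + (r + (suc s + a)) ≡ suc (a + p + q + r) + s
  arcs-ac = solve variables

  arcs-cd : r + (p + q + (suc s + a)) ≡ suc (a + p + q + r) + s
  arcs-cd = solve variables

  arcs-ad : p + q + r + (suc s + a) ≡ suc (a + p + q + r) + s
  arcs-ad = solve variables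

  a+[p+q+r]≡d : a + (p + q + r) ≡ a + p + q + r
  a+[p+q+r]≡d = solve variables

  second-between : p + q ≤ r + w →
    cyclicDist m a b + cyclicDist m b c ≡ cyclicDist m a c
  second-between pq≤rw = begin
    cyclicDist m a b + cyclicDist m b c
      ≡⟨ cong₂ _+_ (cyclicDist-shortArc {x = a} p (q + (r + w)) refl arcs-ab p≤)
                   (cyclicDist-shortArc {x = b} q (p + (r + w)) refl arcs-bc q≤) ⟩
    p + q
      ≡⟨ cyclicDist-shortArc {x = a} (p + q) (r + w) (sym (+-assoc a p q)) arcs-ac pq≤rw ⟨
    cyclicDist m a c ∎
    where
    open ≡-Reasoning
    p≤ : p ≤ q + (r + w)
    p≤ = ≤-trans (m≤m+n p q) (≤-trans pq≤rw (m≤n+m (r + w) q))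
    q≤ : q ≤ p + (r + w)
    q≤ = ≤-trans (m≤n+m q p) (≤-trans pq≤rw (m≤n+m (r + w) p))

  fourth-between : r + w ≤ p + q →
    cyclicDist m c d + cyclicDist m d a ≡ cyclicDist m c a
  fourth-between rw≤pq = begin
    cyclicDist m c d + cyclicDist m d a
      ≡⟨ cong₂ _+_ (cyclicDist-shortArc {x = c} r (p + q + w) refl arcs-cd r≤)
                   (trans (cyclicDist-comm m d a)
                          (cyclicDist-longArc {x = a} (p + q + r) w a+[p+q+r]≡d arcs-ad w≤)) ⟩
    r + w
      ≡⟨ trans (cyclicDist-comm m c a)
               (cyclicDist-longArc {x = a} (p + q) (r + w) (sym (+-assoc a p q)) arcs-ac rw≤pq) ⟨
    cyclicDist m c a ∎
    where
    open ≡-Reasoning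
    r≤ : r ≤ p + q + w
    r≤ = ≤-trans (m≤m+n r w) (≤-trans rw≤pq (m≤m+n (p + q) w))
    w≤ : w ≤ p + q + r
    w≤ = ≤-trans (m≤n+m w r) (≤-trans rw≤pq (m≤m+n (p + q) r))

cyclicDist-between : ∀ {m a b c d} → a ≤ b → b ≤ c → c ≤ d → d < m →
  cyclicDist m a b + cyclicDist m b c ≡ cyclicDist m a c ⊎
  cyclicDist m c d + cyclicDist m d a ≡ cyclicDist m c a
cyclicDist-between {a = a} a≤b b≤c c≤d d<m
  with m≤n⇒∃[o]m+o≡n a≤b | m≤n⇒∃[o]m+o≡n b≤c | m≤n⇒∃[o]m+o≡n c≤d | m≤n⇒∃[o]m+o≡n d<m
... | p , refl | q , refl | r , refl | s , refl with ≤-total (p + q) (r + (suc s + a))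
...   | inj₁ pq≤rw = inj₁ (FourArcs.second-between a p q r s pq≤rw)
...   | inj₂ rw≤pq = inj₂ (FourArcs.fourth-between a p q r s rw≤pq)

module _ (G : Graph) where

  head-∈ : ∀ {u v vs} → WalkL G u v vs → u ∈ vs
  head-∈ (single _) = here refl
  head-∈ (step _ _) = here refl

  last-∈ : ∀ {u v vs} → WalkL G u v vs → v ∈ vs
  last-∈ (single _) = here refl
  last-∈ (step _ p) = there (last-∈ p)

  walk-join : ∀ {u v w vs ws} → WalkL G u v vs → WalkL G v w ws →
    ∃ λ zs → WalkL G u w zs × suc (length zs) ≡ length vs + length ws × ws ⊆ zs
  walk-join {ws = ws} (single _) q = ws , q , refl , λ t∈ → t∈
  walk-join (step uw p) q with walk-join p q
  ... | zs , p++q , |zs| , ws⊆zs = _ , step uw p++q , cong suc |zs| , λ t∈ → there (ws⊆zs t∈)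

  geodesic-through : ∀ {x y z a b} → Dist G x y a → Dist G y z b → Dist G x z (a + b) →
    ∃ λ P → Geodesic G P × x ∈ P × y ∈ P × z ∈ P
  geodesic-through {x} {y} {z} {a} {b} ((vs , x⇝y , |vs|) , _) ((ws , y⇝z , |ws|) , _) dxz
    with walk-join x⇝y y⇝z
  ... | zs , x⇝z , |zs| , ws⊆zs =
    zs , (x , z , x⇝z , subst (Dist G x z) a+b≡ dxz) , head-∈ x⇝z , ws⊆zs (head-∈ y⇝z) , ws⊆zs (last-∈ y⇝z)
    where
    a+b≡ : a + b ≡ length zs ∸ 1
    a+b≡ = sym (cong (_∸ 1) (trans (suc-injective (trans |zs| (cong₂ _+_ |vs| |ws|))) (+-suc a b)))

  AllGeo-lookup : ∀ {P Ps} → AllGeo G Ps → P ∈ Ps → Geodesic G P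
  AllGeo-lookup (geo ∷ _)  (here refl) = geo
  AllGeo-lookup (_ ∷ geos) (there P∈)  = AllGeo-lookup geos P∈

  AllIsoCyc-lookup : ∀ {C Cs} → AllIsoCyc G Cs → C ∈ Cs → Isometric G C
  AllIsoCyc-lookup (iso ∷ _)  (here refl) = iso
  AllIsoCyc-lookup (_ ∷ isos) (there C∈)  = AllIsoCyc-lookup isos C∈

  module _ {S : Subset (Graph.n G)} (gp : GeneralPosition G S) where

    gp⇒¬between : ∀ {x y z a b} → x ∈ₛ S → y ∈ₛ S → z ∈ₛ S → x ≢ y → y ≢ z → x ≢ z →
      Dist G x y a → Dist G y z b → Dist G x z (a + b) → ⊥
    gp⇒¬between xS yS zS x≢y y≢z x≢z dxy dyz dxz with geodesic-through dxy dyz dxz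
    ... | P , geo , x∈P , y∈P , z∈P = gp _ _ _ xS yS zS x≢y y≢z x≢z P geo (x∈P , y∈P , z∈P)

    geodesic-∩-≤2 : ∀ {P} → Geodesic G P → ∀ {ys} → Unique ys → All (_∈ₛ S) ys → All (_∈ P) ys → length ys ≤ 2
    geodesic-∩-≤2 geo {[]}              _ _ _ = z≤n
    geodesic-∩-≤2 geo {_ ∷ []}          _ _ _ = s≤s z≤n
    geodesic-∩-≤2 geo {_ ∷ _ ∷ []}      _ _ _ = s≤s (s≤s z≤n)
    geodesic-∩-≤2 geo {x ∷ y ∷ z ∷ _} ((x≢y ∷ x≢z ∷ _) ∷ (y≢z ∷ _) ∷ _) (xS ∷ yS ∷ zS ∷ _) (x∈P ∷ y∈P ∷ z∈P ∷ _) =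
      ⊥-elim (gp x y z xS yS zS x≢y y≢z x≢z _ geo (x∈P , y∈P , z∈P))

    module _ (C : Cycle G) (iso : Isometric G C) where
      open Cycle C

      private
        module Sorting = Sort (Fin.≤-decTotalOrder m)

      vert-≢ : ∀ {i j} → i ≢ j → vert i ≢ vert j
      vert-≢ i≢j vi≡vj = i≢j (inj vi≡vj)

      ¬between : ∀ {i j k} → vert i ∈ₛ S → vert j ∈ₛ S → vert k ∈ₛ S → i ≢ j → j ≢ k → i ≢ k →
        cdist i j + cdist j k ≢ cdist i k
      ¬between {i} {j} {k} iS jS kS i≢j j≢k i≢k j-between =
        gp⇒¬between iS jS kS (vert-≢ i≢j) (vert-≢ j≢k) (vert-≢ i≢k)
          (iso i j) (iso j k) (subst (Dist G (vert i) (vert k)) (sym j-between) (iso i k))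

      sorted-≤3 : ∀ {is} → Linked (λ i j → toℕ i ≤ toℕ j) is → Unique is → All (λ i → vert i ∈ₛ S) is →
        length is ≤ 3
      sorted-≤3 {[]}                _ _ _ = z≤n
      sorted-≤3 {_ ∷ []}            _ _ _ = s≤s z≤n
      sorted-≤3 {_ ∷ _ ∷ []}        _ _ _ = s≤s (s≤s z≤n)
      sorted-≤3 {_ ∷ _ ∷ _ ∷ []}    _ _ _ = s≤s (s≤s (s≤s z≤n))
      sorted-≤3 {i ∷ j ∷ k ∷ l ∷ _} (i≤j ∷ j≤k ∷ k≤l ∷ _)
        ((i≢j ∷ i≢k ∷ i≢l ∷ _) ∷ (j≢k ∷ _) ∷ (k≢l ∷ _) ∷ _) (iS ∷ jS ∷ kS ∷ lS ∷ _)
        with cyclicDist-between i≤j j≤k k≤l (Fin.toℕ<n l)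
      ... | inj₁ j-between = ⊥-elim (¬between iS jS kS i≢j j≢k i≢k j-between)
      ... | inj₂ l-between = ⊥-elim (¬between kS lS iS k≢l (≢-sym i≢l) (≢-sym i≢k) l-between)

      positions-≤3 : ∀ is → Unique is → All (λ i → vert i ∈ₛ S) is → length is ≤ 3
      positions-≤3 is u is⊆S = subst (_≤ 3) (↭-length sort↭is)
        (sorted-≤3 (Sorting.sort-↗ is)
                   (Permutation.Unique-resp-↭ (setoid (Fin m)) (↭⇒↭ₛ (↭-sym sort↭is)) u)
                   (All-resp-↭ (↭-sym sort↭is) is⊆S))
        where
        sort↭is : Sorting.sort is ↭ is
        sort↭is = Sorting.sort-↭ is

      positions : ∀ {ys} → All (λ x → OnCycle G x C) ys → ∃ λ is → map vert is ≡ ys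
      positions [] = [] , refl
      positions ((i , refl) ∷ on) with positions on
      ... | is , refl = i ∷ is , refl

      isometricCycle-∩-≤3 : ∀ {ys} → Unique ys → All (_∈ₛ S) ys → All (λ x → OnCycle G x C) ys → length ys ≤ 3
      isometricCycle-∩-≤3 u ys⊆S on with positions on
      ... | is , refl = subst (_≤ 3) (sym (length-map vert is))
                              (positions-≤3 is (Unique.map⁻ u) (All.map⁻ ys⊆S))

corollary3p2 : (G : Graph) → Connected G →
    (∀ g i → IsGP G g → IsIP G i → g ≤ 2 * i) ×
    (∀ g c → IsGP G g → IsIC G c → g ≤ 3 * c)
corollary3p2 G _ = gp≤2ip , gp≤3ic
  where
  open Graph G using (n)
  open import Data.List.Membership.DecPropositional (Fin._≟_ {n}) using (_∈?_)

  gp≤2ip : ∀ g i → IsGP G g → IsIP G i → g ≤ 2 * i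
  gp≤2ip _ _ ((S , gpS , refl) , _) ((Ps , (geodesics , covers) , refl) , _) =
    ∣p∣≤k*length _∈?_ S 2 Ps covers λ P∈Ps → geodesic-∩-≤2 G gpS (AllGeo-lookup G geodesics P∈Ps)

  gp≤3ic : ∀ g c → IsGP G g → IsIC G c → g ≤ 3 * c
  gp≤3ic _ _ ((S , gpS , refl) , _) ((Cs , (cycles , covers) , refl) , _) =
    ∣p∣≤k*length (λ x C → Fin.any? λ i → Cycle.vert C i Fin.≟ x) S 3 Cs covers
      λ {C} C∈Cs → isometricCycle-∩-≤3 G gpS C (AllIsoCyc-lookup G cycles C∈Cs)
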